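{- For every $n\in\mathbb{N}$, $F(n)\le\sqrt{n+1}$, and equality holds if and only if $n=f_r^2-1$ for some $r\in\mathbb{N}$.
   Context: $f_0=f_1=1$, $f_i=f_{i-1}+f_{i-2}$ ($i\ge2$). A Fibonacci partition of $n\in\mathbb{N}$ is a finite set $\{f_{i_1},\dots,f_{i_h}\}$ with $1\le i_1<\dots<i_h$ and $f_{i_1}+\dots+f_{i_h}=n$ (the empty set for $n=0$); $F(n)$ is the number of Fibonacci partitions of $n$, i.e. $\prod_{i\ge1}(1+x^{f_i})=\sum_{n\ge0}F(n)x^n$. -}

module Defs where

open import Data.Nat using (ℕ; zero; suc; _+_; _∸_; _≤?_)
open import Relation.Nullary using (yes; no)

fib : ℕ → ℕ
fib zero = 1
fib (suc zero) = 1
fib (suc (suc i)) = fib (suc i) + fib i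

-- partitionsUpTo n k = number of subsets S ⊆ {1,…,k} of indices with
-- Σ_{i ∈ S} fib i = n, i.e. the coefficient of x^n in ∏_{i=1}^{k} (1 + x^{fib i}).
partitionsUpTo : ℕ → ℕ → ℕ
partitionsUpTo zero    zero    = 1
partitionsUpTo (suc _) zero    = 0
partitionsUpTo n       (suc k) with fib (suc k) ≤? n
... | yes _ = partitionsUpTo n k + partitionsUpTo (n ∸ fib (suc k)) k
... | no  _ = partitionsUpTo n k

-- Since fib i ≥ i, indices
-- i > n can never occur in a partition of n, so subsets of {1,…,n} suffice
-- (for n = 0 this gives the single empty partition).
F : ℕ → ℕ
F n = partitionsUpTo n n

-- Write n = f_{j+1} + m with m < f_j.  Sorting partitions by whether they use f_{j+1}, and using
-- that complementation inside {f_1, …, f_k} is a symmetry, gives F(n) = F(m) when m + 1 = f_j and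
-- F(n) = F(m) + F(m′) when (m + 1) + (m′ + 1) = f_j.  Since n + 1 = (m + 1) + (m′ + 1) + f_{j-1} + m + 1,
-- the induction hypotheses F(m)² ≤ m + 1 and F(m′)² ≤ m′ + 1 reduce F(n)² ≤ n + 1 to the cross-term
-- bound 2 F(m) F(m′) ≤ f_{j-1} + m + 1.  This is AM-GM when m + 1 ≥ f_{j-2}; otherwise
-- m′ = f_{j-1} + q with (q + 1) + (m + 1) = f_{j-2}, so F(m′) = F(q) + F(m), and the same bound for
-- (q , m) closes an induction on j.  Tracking equality through every inequality shows that it forces
-- m + 1 = f_a², m′ + 1 = f_{a+1}² and j = 2a + 2, whence n + 1 = f_{2a+3} + f_a² = f_{a+2}².
-- Conversely F(f_r² - 1) = f_r by the same recursion, as f_a² + f_{a+1}² = f_{2a+2}.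
module Submission where

open import Defs
open import Data.Nat
open import Data.Nat.Properties
open import Data.Nat.Induction using (<-rec)
open import Data.Nat.Tactic.RingSolver using (solve-∀)
open import Data.Product using (_×_; ∃-syntax; _,_; proj₁; proj₂)
open import Data.Sum using (inj₁; inj₂)
open import Function.Bundles using (_⇔_; mk⇔)
open import Relation.Binary.PropositionalEquality
open import Relation.Nullary using (yes; no; contradiction)

fib-pos : ∀ n → 0 < fib n
fib-pos zero          = z<s
fib-pos (suc zero)    = z<s
fib-pos (suc (suc n)) = <-≤-trans (fib-pos (suc n)) (m≤m+n _ _)

fib-≤-suc : ∀ n → fib n ≤ fib (suc n)
fib-≤-suc zero    = ≤-refl
fib-≤-suc (suc n) = m≤m+n _ _

fib-<-suc : ∀ n → fib (suc n) < fib (2 + n)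
fib-<-suc n = m<m+n (fib (suc n)) (fib-pos n)

fib-mono′ : ∀ {m n} → m ≤′ n → fib m ≤ fib n
fib-mono′ ≤′-refl         = ≤-refl
fib-mono′ (≤′-step {n} m≤′n) = ≤-trans (fib-mono′ m≤′n) (fib-≤-suc n)

fib-mono : ∀ {m n} → m ≤ n → fib m ≤ fib n
fib-mono m≤n = fib-mono′ (≤⇒≤′ m≤n)

n<fib[1+n] : ∀ n → n < fib (suc n)
n<fib[1+n] zero    = z<s
n<fib[1+n] (suc n) = ≤-trans (s≤s (n<fib[1+n] n)) (fib-<-suc n)

fib≡fib[1+i]⇒i≡0 : ∀ i → fib i ≡ fib (suc i) → i ≡ 0
fib≡fib[1+i]⇒i≡0 zero    _  = refl
fib≡fib[1+i]⇒i≡0 (suc i) eq = contradiction eq (<⇒≢ (fib-<-suc i))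

fib-+ : ∀ a b → fib (2 + (a + b)) ≡ fib (suc a) * fib (suc b) + fib a * fib b
fib-+ zero    b = sym (cong₂ _+_ (+-identityʳ (fib (suc b))) (+-identityʳ (fib b)))
fib-+ (suc a) b = begin
  fib (2 + (suc a + b))                           ≡⟨ cong (λ k → fib (2 + k)) (sym (+-suc a b)) ⟩
  fib (2 + (a + suc b))                           ≡⟨ fib-+ a (suc b) ⟩
  fib (suc a) * fib (2 + b) + fib a * fib (suc b) ≡⟨ regroup (fib (suc a)) (fib a) _ _ ⟩
  fib (2 + a) * fib (suc b) + fib (suc a) * fib b ∎
  where
  open ≡-Reasoning
  regroup : ∀ p q r s → p * (r + s) + q * r ≡ (p + q) * r + p * s
  regroup = solve-∀

fib²+fib²≡fib : ∀ a → fib a * fib a + fib (suc a) * fib (suc a) ≡ fib (2 + (a + a))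
fib²+fib²≡fib a = trans (+-comm (fib a * fib a) _) (sym (fib-+ a a))

fib+fib²≡fib² : ∀ a → fib (3 + (a + a)) + fib a * fib a ≡ fib (2 + a) * fib (2 + a)
fib+fib²≡fib² a = trans (cong (_+ fib a * fib a) (fib-+ (suc a) a)) (square (fib (suc a)) (fib a))
  where
  square : ∀ p q → (p + q) * p + p * q + q * q ≡ (p + q) * (p + q)
  square = solve-∀

fib²≡suc : ∀ a → ∃[ m ] suc m ≡ fib a * fib a
fib²≡suc a = m≤n⇒∃[o]m+o≡n (*-mono-≤ (fib-pos a) (fib-pos a))

fib-block : ∀ n → ∃[ j ] ∃[ m ] (suc n ≡ fib (suc j) + m) × (suc m ≤ fib j)
fib-block zero = 0 , 0 , refl , s≤s z≤n
fib-block (suc n) with fib-block n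
... | j , m , e , 1+m≤f with m≤n⇒m<n∨m≡n 1+m≤f
...   | inj₁ 1+m<f = j , suc m , trans (cong suc e) (sym (+-suc _ m)) , 1+m<f
...   | inj₂ 1+m≡f = suc j , 0 , (begin
  suc (suc n)            ≡⟨ cong suc e ⟩
  suc (fib (suc j) + m)  ≡⟨ +-suc _ m ⟨
  fib (suc j) + suc m    ≡⟨ cong (fib (suc j) +_) 1+m≡f ⟩
  fib (suc j) + fib j    ≡⟨ +-identityʳ _ ⟨
  fib (2 + j) + 0        ∎) , fib-pos (suc j)
  where open ≡-Reasoning

fibSum : ℕ → ℕ
fibSum zero    = 0
fibSum (suc k) = fibSum k + fib (suc k)

fibSum+2 : ∀ k → fibSum k + 2 ≡ fib (2 + k)
fibSum+2 zero    = refl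
fibSum+2 (suc k) = begin
  fibSum k + fib (suc k) + 2 ≡⟨ swap (fibSum k) (fib (suc k)) ⟩
  fibSum k + 2 + fib (suc k) ≡⟨ cong (_+ fib (suc k)) (fibSum+2 k) ⟩
  fib (2 + k) + fib (suc k)  ∎
  where
  open ≡-Reasoning
  swap : ∀ s f → s + f + 2 ≡ s + 2 + f
  swap = solve-∀

fibSum<fib : ∀ k → fibSum k < fib (2 + k)
fibSum<fib k = <-≤-trans (m<m+n (fibSum k) z<s) (≤-reflexive (fibSum+2 k))

-- partitionsUpTo n (suc k) only reduces once n is a constructor.
partitionsUpTo-skip : ∀ {n} k → n < fib (suc k) → partitionsUpTo n (suc k) ≡ partitionsUpTo n k
partitionsUpTo-skip {zero} k n<f with fib (suc k) ≤? zero
... | yes f≤n = contradiction f≤n (<⇒≱ n<f)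
... | no  _   = refl
partitionsUpTo-skip {suc n} k n<f with fib (suc k) ≤? suc n
... | yes f≤n = contradiction f≤n (<⇒≱ n<f)
... | no  _   = refl

partitionsUpTo-take-≤ : ∀ {n} k → fib (suc k) ≤ n →
  partitionsUpTo n (suc k) ≡ partitionsUpTo n k + partitionsUpTo (n ∸ fib (suc k)) k
partitionsUpTo-take-≤ {zero} k f≤0 = contradiction f≤0 (<⇒≱ (fib-pos (suc k)))
partitionsUpTo-take-≤ {suc n} k f≤n with fib (suc k) ≤? suc n
... | yes _   = refl
... | no  f≰n = contradiction f≤n f≰n

partitionsUpTo-take : ∀ k a →
  partitionsUpTo (fib (suc k) + a) (suc k) ≡ partitionsUpTo (fib (suc k) + a) k + partitionsUpTo a k
partitionsUpTo-take k a = trans (partitionsUpTo-take-≤ k (m≤m+n _ a))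
  (cong (λ b → partitionsUpTo (fib (suc k) + a) k + partitionsUpTo b k) (m+n∸m≡n (fib (suc k)) a))

partitionsUpTo-beyond : ∀ k {n} → fibSum k < n → partitionsUpTo n k ≡ 0
partitionsUpTo-beyond zero    {suc n} _   = refl
partitionsUpTo-beyond (suc k) {n}     S<n with fib (suc k) ≤? n
... | no f≰n = trans (partitionsUpTo-skip k (≰⇒> f≰n)) (partitionsUpTo-beyond k (m+n≤o⇒m≤o _ S<n))
... | yes f≤n with m≤n⇒∃[o]m+o≡n f≤n
...   | a , refl = trans (partitionsUpTo-take k a)
                         (cong₂ _+_ (partitionsUpTo-beyond k (m+n≤o⇒m≤o _ S<n)) (partitionsUpTo-beyond k S<a))
  where
  S<a : fibSum k < a
  S<a = +-cancelˡ-< (fib (suc k)) _ _ (subst (_< fib (suc k) + a) (+-comm (fibSum k) _) S<n)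

-- Complementation S ↦ {1,…,k} ∖ S is a bijection between partitions of a and of fibSum k ∸ a.
partitionsUpTo-complement : ∀ k a b → a + b ≡ fibSum k → partitionsUpTo a k ≡ partitionsUpTo b k

complement-with-top : ∀ k {a b} → fib (suc k) ≤ a → a + b ≡ fibSum (suc k) →
  partitionsUpTo a (suc k) ≡ partitionsUpTo b (suc k)
complement-with-top k {b = b} f≤a eq with m≤n⇒∃[o]m+o≡n f≤a | fib (suc k) ≤? b
... | a′ , refl | no f≰b = begin
  P (f + a′) (suc k)     ≡⟨ partitionsUpTo-take k a′ ⟩
  P (f + a′) k + P a′ k  ≡⟨ cong₂ _+_ (partitionsUpTo-beyond k S<f+a′)
                                      (partitionsUpTo-complement k a′ _ a′+b≡S) ⟩
  P b k                  ≡⟨ partitionsUpTo-skip k (≰⇒> f≰b) ⟨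
  P b (suc k)            ∎
  where
  open ≡-Reasoning
  P : ℕ → ℕ → ℕ
  P = partitionsUpTo
  f : ℕ
  f = fib (suc k)
  a′+b≡S : a′ + b ≡ fibSum k
  a′+b≡S = +-cancelˡ-≡ f _ _ (trans (sym (+-assoc f a′ b)) (trans eq (+-comm (fibSum k) f)))
  S<f+a′ : fibSum k < f + a′
  S<f+a′ = subst₂ _<_ a′+b≡S (+-comm a′ f) (+-monoʳ-< a′ (≰⇒> f≰b))
... | a′ , refl | yes f≤b with m≤n⇒∃[o]m+o≡n f≤b
...   | b′ , refl = begin
  P (f + a′) (suc k)     ≡⟨ partitionsUpTo-take k a′ ⟩
  P (f + a′) k + P a′ k  ≡⟨ cong₂ _+_ (partitionsUpTo-complement k _ b′ (trans (shift f a′ b′) a′+b≡S))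
                                      (partitionsUpTo-complement k a′ _ a′+b≡S) ⟩
  P b′ k + P (f + b′) k  ≡⟨ +-comm (P b′ k) _ ⟩
  P (f + b′) k + P b′ k  ≡⟨ partitionsUpTo-take k b′ ⟨
  P (f + b′) (suc k)     ∎
  where
  open ≡-Reasoning
  P : ℕ → ℕ → ℕ
  P = partitionsUpTo
  f : ℕ
  f = fib (suc k)
  a′+b≡S : a′ + (f + b′) ≡ fibSum k
  a′+b≡S = +-cancelˡ-≡ f _ _ (trans (sym (+-assoc f a′ (f + b′))) (trans eq (+-comm (fibSum k) f)))
  shift : ∀ f x y → f + x + y ≡ x + (f + y)
  shift = solve-∀

partitionsUpTo-complement zero    zero zero _ = refl
partitionsUpTo-complement (suc k) a b eq with fib (suc k) ≤? a | fib (suc k) ≤? b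
... | yes f≤a | _       = complement-with-top k f≤a eq
... | no  _   | yes f≤b = sym (complement-with-top k f≤b (trans (+-comm b a) eq))
... | no  f≰a | no  f≰b = begin
  partitionsUpTo a (suc k) ≡⟨ partitionsUpTo-skip k (≰⇒> f≰a) ⟩
  partitionsUpTo a k       ≡⟨ partitionsUpTo-beyond k (+-cancelʳ-< (fib (suc k)) _ _ S+f<a+f) ⟩
  0                        ≡⟨ partitionsUpTo-beyond k (+-cancelʳ-< (fib (suc k)) _ _ S+f<b+f) ⟨
  partitionsUpTo b k       ≡⟨ partitionsUpTo-skip k (≰⇒> f≰b) ⟨
  partitionsUpTo b (suc k) ∎
  where
  open ≡-Reasoning
  S+f<a+f : fibSum k + fib (suc k) < a + fib (suc k)
  S+f<a+f = subst (_< a + fib (suc k)) eq (+-monoʳ-< a (≰⇒> f≰b))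
  S+f<b+f : fibSum k + fib (suc k) < b + fib (suc k)
  S+f<b+f = subst (_< b + fib (suc k)) (trans (+-comm b a) eq) (+-monoʳ-< b (≰⇒> f≰a))

partitionsUpTo-extend : ∀ {n k l} → n < fib (suc k) → k ≤′ l →
  partitionsUpTo n k ≡ partitionsUpTo n l
partitionsUpTo-extend n<f ≤′-refl = refl
partitionsUpTo-extend n<f (≤′-step {l} k≤′l) =
  trans (partitionsUpTo-extend n<f k≤′l)
        (sym (partitionsUpTo-skip l (<-≤-trans n<f (fib-mono (s≤s (≤′⇒≤ k≤′l))))))

partitionsUpTo-stable : ∀ {n k} → n < fib (suc k) → partitionsUpTo n k ≡ F n
partitionsUpTo-stable {n} {k} n<f with ≤-total k n
... | inj₁ k≤n = partitionsUpTo-extend n<f (≤⇒≤′ k≤n)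
... | inj₂ n≤k = sym (partitionsUpTo-extend (n<fib[1+n] n) (≤⇒≤′ n≤k))

F-split : ∀ i {m o} → suc m + suc o ≡ fib (suc i) → F (fib (2 + i) + m) ≡ F m + F o
F-split i {m} {o} e = begin
  F (fib (2 + i) + m)                        ≡⟨ partitionsUpTo-stable (+-monoʳ-< (fib (2 + i)) m<f) ⟨
  P (fib (2 + i) + m) (2 + i)                ≡⟨ partitionsUpTo-take (suc i) m ⟩
  P (fib (2 + i) + m) (suc i) + P m (suc i)  ≡⟨ cong₂ _+_ without-top (partitionsUpTo-stable m<f′) ⟩
  F o + F m                                  ≡⟨ +-comm (F o) (F m) ⟩
  F m + F o                                  ∎
  where
  open ≡-Reasoning
  P : ℕ → ℕ → ℕ
  P = partitionsUpTo
  m<f : m < fib (suc i)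
  m<f = m+n≤o⇒m≤o (suc m) (≤-reflexive e)
  m<f′ : m < fib (2 + i)
  m<f′ = <-≤-trans m<f (fib-≤-suc (suc i))
  complement : fib i + m + o ≡ fibSum i
  complement = +-cancelʳ-≡ 2 _ _ (begin
    fib i + m + o + 2       ≡⟨ regroup (fib i) m o ⟩
    suc m + suc o + fib i   ≡⟨ cong (_+ fib i) e ⟩
    fib (2 + i)             ≡⟨ fibSum+2 i ⟨
    fibSum i + 2            ∎)
    where
    regroup : ∀ f m o → f + m + o + 2 ≡ suc m + suc o + f
    regroup = solve-∀
  without-top : P (fib (2 + i) + m) (suc i) ≡ F o
  without-top = begin
    P (fib (2 + i) + m) (suc i)
      ≡⟨ cong (λ n → P n (suc i)) (+-assoc (fib (suc i)) (fib i) m) ⟩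
    P (fib (suc i) + (fib i + m)) (suc i)
      ≡⟨ partitionsUpTo-take i (fib i + m) ⟩
    P (fib (suc i) + (fib i + m)) i + P (fib i + m) i
      ≡⟨ cong₂ _+_ (partitionsUpTo-beyond i S<) (partitionsUpTo-complement i _ o complement) ⟩
    P o i
      ≡⟨ partitionsUpTo-stable (m+n≤o⇒n≤o (suc m) (≤-reflexive e)) ⟩
    F o
      ∎
    where
    S< : fibSum i < fib (suc i) + (fib i + m)
    S< = <-≤-trans (fibSum<fib i) (+-monoʳ-≤ (fib (suc i)) (m≤m+n (fib i) m))

F-edge : ∀ j {m} → suc m ≡ fib j → F (fib (suc j) + m) ≡ F m
F-edge j {m} e = begin
  F (fib (suc j) + m)            ≡⟨ partitionsUpTo-stable (+-monoʳ-< (fib (suc j)) (≤-reflexive e)) ⟨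
  P (fib (suc j) + m) (suc j)    ≡⟨ partitionsUpTo-take j m ⟩
  P (fib (suc j) + m) j + P m j  ≡⟨ cong₂ _+_ (partitionsUpTo-beyond j (≤-reflexive S+1≡))
                                              (partitionsUpTo-stable m<f) ⟩
  F m                            ∎
  where
  open ≡-Reasoning
  P : ℕ → ℕ → ℕ
  P = partitionsUpTo
  m<f : m < fib (suc j)
  m<f = ≤-trans (≤-reflexive e) (fib-≤-suc j)
  S+1≡ : suc (fibSum j) ≡ fib (suc j) + m
  S+1≡ = suc-injective (begin
    2 + fibSum j          ≡⟨ +-comm 2 (fibSum j) ⟩
    fibSum j + 2          ≡⟨ fibSum+2 j ⟩
    fib (suc j) + fib j   ≡⟨ cong (fib (suc j) +_) e ⟨
    fib (suc j) + suc m   ≡⟨ +-suc (fib (suc j)) m ⟩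
    suc (fib (suc j) + m) ∎)

infix 4 _≤[_]_
record _≤[_]_ (a : ℕ) (Q : Set) (b : ℕ) : Set where
  constructor mk≤[]
  field
    bound    : a ≤ b
    equality : a ≡ b → Q
open _≤[_]_

private
  variable
    a b c d : ℕ
    Q R : Set

<⇒≤[] : a < b → a ≤[ Q ] b
<⇒≤[] a<b = mk≤[] (<⇒≤ a<b) (λ a≡b → contradiction a≡b (<⇒≢ a<b))

≤⇒≤[≡] : a ≤ b → a ≤[ a ≡ b ] b
≤⇒≤[≡] a≤b = mk≤[] a≤b (λ a≡b → a≡b)

≤[]-map : (Q → R) → a ≤[ Q ] b → a ≤[ R ] b
≤[]-map f (mk≤[] a≤b tight) = mk≤[] a≤b (λ a≡b → f (tight a≡b))

≤[]-resp : a ≡ c → b ≡ d → a ≤[ Q ] b → c ≤[ Q ] d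
≤[]-resp refl refl a≤b = a≤b

≤[]-trans : a ≤[ Q ] b → b ≤[ R ] c → a ≤[ Q × R ] c
≤[]-trans (mk≤[] a≤b Q-tight) (mk≤[] b≤c R-tight) = mk≤[] (≤-trans a≤b b≤c) λ a≡c →
  let a≡b = ≤-antisym a≤b (≤-trans b≤c (≤-reflexive (sym a≡c)))
  in Q-tight a≡b , R-tight (trans (sym a≡b) a≡c)

≤[]-+ : a ≤[ Q ] c → b ≤[ R ] d → a + b ≤[ Q × R ] c + d
≤[]-+ {a = a} {c = c} {b = b} {d = d} (mk≤[] a≤c Q-tight) (mk≤[] b≤d R-tight) =
  mk≤[] (+-mono-≤ a≤c b≤d) λ eq →
  let c≤a = +-cancelʳ-≤ d c a (≤-trans (≤-reflexive (sym eq)) (+-monoʳ-≤ a b≤d))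
      a≡c = ≤-antisym a≤c c≤a
  in Q-tight a≡c , R-tight (+-cancelˡ-≡ a b d (trans eq (cong (_+ d) (sym a≡c))))

am-gm-≤ : ∀ {x y} → x ≤ y → 2 * (x * y) ≤[ x ≡ y ] x * x + y * y
am-gm-≤ {x} x≤y with m≤n⇒∃[o]m+o≡n x≤y
... | d , refl = ≤[]-resp refl (sym (square-gap x d)) (gap d)
  where
  square-gap : ∀ x d → x * x + (x + d) * (x + d) ≡ 2 * (x * (x + d)) + d * d
  square-gap = solve-∀
  gap : ∀ d → 2 * (x * (x + d)) ≤[ x ≡ x + d ] 2 * (x * (x + d)) + d * d
  gap zero    = mk≤[] (m≤m+n _ 0) (λ _ → sym (+-identityʳ x))
  gap (suc d) = <⇒≤[] (m<m+n _ z<s)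

am-gm : ∀ x y → 2 * (x * y) ≤[ x ≡ y ] x * x + y * y
am-gm x y with ≤-total x y
... | inj₁ x≤y = am-gm-≤ x≤y
... | inj₂ y≤x =
  ≤[]-resp (cong (2 *_) (*-comm y x)) (+-comm (y * y) (x * x)) (≤[]-map sym (am-gm-≤ y≤x))

IsFibSquare : ℕ → Set
IsFibSquare n = ∃[ r ] n ≡ fib r * fib r

ConsecutiveFibSquares : ℕ → ℕ → ℕ → Set
ConsecutiveFibSquares i m o =
  ∃[ a ] (i ≡ a + a) × (suc m ≡ fib a * fib a) × (suc o ≡ fib (suc a) * fib (suc a))

SquareBound : ℕ → Set
SquareBound n = F n * F n ≤[ IsFibSquare (suc n) ] suc n

SquareBoundBelow : ℕ → Set
SquareBoundBelow N = ∀ {x} → x < N → SquareBound x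

fib[3+2a]+fib²≡fib² : ∀ a {t q} → t ≡ a + a → suc q ≡ fib a * fib a →
  suc (fib (3 + t) + q) ≡ fib (2 + a) * fib (2 + a)
fib[3+2a]+fib²≡fib² a {t} {q} t≡a+a 1+q≡ = begin
  suc (fib (3 + t) + q)                  ≡⟨ +-suc (fib (3 + t)) q ⟨
  fib (3 + t) + suc q                    ≡⟨ cong₂ _+_ (cong (λ s → fib (3 + s)) t≡a+a) 1+q≡ ⟩
  fib (3 + (a + a)) + fib a * fib a      ≡⟨ fib+fib²≡fib² a ⟩
  fib (2 + a) * fib (2 + a)              ∎
  where open ≡-Reasoning

cross-bound-balanced : ∀ i {m o} → SquareBoundBelow (fib (2 + i)) → suc m + suc o ≡ fib (2 + i) →
  fib i ≤ suc m → 2 * (F m * F o) ≤[ ConsecutiveFibSquares i m o ] fib (suc i) + suc m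
cross-bound-balanced i {m} {o} ih e fᵢ≤1+m =
  ≤[]-map consecutive (≤[]-trans (≤[]-trans (am-gm (F m) (F o)) squares) top)
  where
  squares : F m * F m + F o * F o ≤[ (F m * F m ≡ suc m) × (F o * F o ≡ suc o) ] suc m + suc o
  squares = ≤[]-+ (≤⇒≤[≡] (bound (ih (m+n≤o⇒m≤o (suc m) (≤-reflexive e)))))
                  (≤⇒≤[≡] (bound (ih (m+n≤o⇒n≤o (suc m) (≤-reflexive e)))))
  top : suc m + suc o ≤[ fib i ≡ suc m ] fib (suc i) + suc m
  top = ≤[]-resp (sym e) refl
          (≤[]-map (+-cancelˡ-≡ (fib (suc i)) _ _) (≤⇒≤[≡] (+-monoʳ-≤ (fib (suc i)) fᵢ≤1+m)))
  consecutive : (F m ≡ F o × (F m * F m ≡ suc m) × (F o * F o ≡ suc o)) × fib i ≡ suc m →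
    ConsecutiveFibSquares i m o
  consecutive ((Fm≡Fo , Fm²≡ , Fo²≡) , fᵢ≡1+m) = 0 , i≡0 , 1+m≡1 , trans (sym 1+m≡1+o) 1+m≡1
    where
    1+m≡1+o : suc m ≡ suc o
    1+m≡1+o = trans (sym Fm²≡) (trans (cong (λ x → x * x) Fm≡Fo) Fo²≡)
    i≡0 : i ≡ 0
    i≡0 = fib≡fib[1+i]⇒i≡0 i
            (+-cancelʳ-≡ (fib i) _ _ (trans (cong₂ _+_ fᵢ≡1+m (trans fᵢ≡1+m 1+m≡1+o)) e))
    1+m≡1 : suc m ≡ 1
    1+m≡1 = trans (sym fᵢ≡1+m) (cong fib i≡0)

summand-≡ : ∀ {m o q f g} → suc m + suc o ≡ f + g → suc (suc m) + q ≡ g → o ≡ f + q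
summand-≡ {m} {q = q} {f = f} e refl = suc-injective (+-cancelˡ-≡ (suc m) _ _ (trans e (shift f m q)))
  where
  shift : ∀ f m q → f + (suc (suc m) + q) ≡ suc m + suc (f + q)
  shift = solve-∀

cross-bound : ∀ i {m o} → SquareBoundBelow (fib (2 + i)) → suc m + suc o ≡ fib (2 + i) →
  2 * (F m * F o) ≤[ ConsecutiveFibSquares i m o ] fib (suc i) + suc m

cross-bound-unbalanced : ∀ t {m o} → SquareBoundBelow (fib (4 + t)) → suc m + suc o ≡ fib (4 + t) →
  suc m < fib (2 + t) → 2 * (F m * F o) ≤[ ConsecutiveFibSquares (2 + t) m o ] fib (3 + t) + suc m
cross-bound-unbalanced t {m} ih e 1+m<f with m≤n⇒∃[o]m+o≡n 1+m<f
... | q , 2+m+q≡f with summand-≡ {f = fib (3 + t)} e 2+m+q≡f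
...   | refl = ≤[]-map next-pair (≤[]-resp lhs rhs
                 (≤[]-+ (cross-bound t ih′ q+m) (≤⇒≤[≡] (*-monoʳ-≤ 2 (bound (ih m<f))))))
  where
  q+m : suc q + suc m ≡ fib (2 + t)
  q+m = trans (+-comm (suc q) (suc m)) (trans (cong suc (+-suc m q)) 2+m+q≡f)
  m<f : m < fib (4 + t)
  m<f = m+n≤o⇒m≤o (suc m) (≤-reflexive e)
  ih′ : SquareBoundBelow (fib (2 + t))
  ih′ x<f = ih (<-≤-trans x<f (fib-mono (m≤n+m (2 + t) 2)))
  lhs : 2 * (F q * F m) + 2 * (F m * F m) ≡ 2 * (F m * F (fib (3 + t) + q))
  lhs = trans (expand (F m) (F q)) (cong (λ z → 2 * (F m * z)) (sym (F-split (suc t) q+m)))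
    where
    expand : ∀ x z → 2 * (z * x) + 2 * (x * x) ≡ 2 * (x * (z + x))
    expand = solve-∀
  rhs : fib (suc t) + suc q + 2 * suc m ≡ fib (3 + t) + suc m
  rhs = trans (regroup (fib (suc t)) q m) (cong (λ s → s + fib (suc t) + suc m) q+m)
    where
    regroup : ∀ f q m → f + suc q + 2 * suc m ≡ suc q + suc m + f + suc m
    regroup = solve-∀
  next-pair : ConsecutiveFibSquares t q m × (2 * (F m * F m) ≡ 2 * suc m) →
    ConsecutiveFibSquares (2 + t) m (fib (3 + t) + q)
  next-pair ((a , t≡a+a , 1+q≡ , 1+m≡) , _) =
    suc a , trans (cong (2 +_) t≡a+a) (cong suc (sym (+-suc a a))) , 1+m≡ ,
    fib[3+2a]+fib²≡fib² a t≡a+a 1+q≡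

cross-bound zero          ih e = cross-bound-balanced 0 ih e (s≤s z≤n)
cross-bound (suc zero)    ih e = cross-bound-balanced 1 ih e (s≤s z≤n)
cross-bound (suc (suc t)) {m} ih e with fib (2 + t) ≤? suc m
... | yes f≤1+m = cross-bound-balanced (2 + t) ih e f≤1+m
... | no  f≰1+m = cross-bound-unbalanced t ih e (≰⇒> f≰1+m)

square-bound-edge : ∀ j {n m} → SquareBoundBelow (suc n) → suc n ≡ fib (suc j) + m → suc m ≡ fib j →
  SquareBound (suc n)
square-bound-edge j {n} {m} ih e 1+m≡f = <⇒≤[] (begin-strict
  F (suc n) * F (suc n) ≡⟨ cong (λ x → x * x) (trans (cong F e) (F-edge j 1+m≡f)) ⟩
  F m * F m             ≤⟨ bound (ih m<1+n) ⟩
  suc m                 ≤⟨ m<1+n ⟩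
  suc n                 <⟨ n<1+n (suc n) ⟩
  suc (suc n)           ∎)
  where
  open ≤-Reasoning
  m<1+n : m < suc n
  m<1+n = <-≤-trans (m<n+m m (fib-pos (suc j))) (≤-reflexive (sym e))

square-bound-split : ∀ i {n m o} → SquareBoundBelow (suc n) → suc n ≡ fib (3 + i) + m →
  suc m + suc o ≡ fib (2 + i) → SquareBound (suc n)
square-bound-split i {n} {m} {o} ih e h = ≤[]-map fib-square (≤[]-resp (sym lhs) (sym rhs)
  (≤[]-+ (≤[]-+ (≤⇒≤[≡] (bound (ih m<1+n))) (≤⇒≤[≡] (bound (ih o<1+n)))) (cross-bound i ih′ h)))
  where
  fib≤1+n : fib (2 + i) ≤ suc n
  fib≤1+n = ≤-trans (fib-≤-suc (2 + i)) (≤-trans (m≤m+n _ m) (≤-reflexive (sym e)))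
  ih′ : SquareBoundBelow (fib (2 + i))
  ih′ x<f = ih (<-≤-trans x<f fib≤1+n)
  m<1+n : m < suc n
  m<1+n = <-≤-trans (m<n+m m (fib-pos (3 + i))) (≤-reflexive (sym e))
  o<1+n : o < suc n
  o<1+n = <-≤-trans (m+n≤o⇒n≤o (suc m) (≤-reflexive h)) fib≤1+n
  lhs : F (suc n) * F (suc n) ≡ (F m * F m + F o * F o) + 2 * (F m * F o)
  lhs = trans (cong (λ x → x * x) (trans (cong F e) (F-split (suc i) h))) (square (F m) (F o))
    where
    square : ∀ x y → (x + y) * (x + y) ≡ (x * x + y * y) + 2 * (x * y)
    square = solve-∀
  rhs : suc (suc n) ≡ (suc m + suc o) + (fib (suc i) + suc m)
  rhs = trans (cong suc e)
          (trans (cong (λ s → suc (s + fib (suc i) + m)) (sym h)) (regroup (suc m + suc o) (fib (suc i)) m))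
    where
    regroup : ∀ s f m → suc (s + f + m) ≡ s + (f + suc m)
    regroup = solve-∀
  fib-square : ((F m * F m ≡ suc m) × (F o * F o ≡ suc o)) × ConsecutiveFibSquares i m o →
    IsFibSquare (suc (suc n))
  fib-square (_ , a , i≡a+a , 1+m≡ , _) = 2 + a , trans (cong suc e) (fib[3+2a]+fib²≡fib² a i≡a+a 1+m≡)

square-bound-step : ∀ n → SquareBoundBelow n → SquareBound n
square-bound-step zero    _  = mk≤[] ≤-refl (λ _ → 0 , refl)
square-bound-step (suc n) ih with fib-block n
... | j , m , e , 1+m≤f with m≤n⇒m<n∨m≡n 1+m≤f
...   | inj₂ 1+m≡f = square-bound-edge j ih e 1+m≡f
square-bound-step (suc n) ih | zero          , m , e , _ | inj₁ (s≤s ())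
square-bound-step (suc n) ih | suc zero      , m , e , _ | inj₁ (s≤s ())
square-bound-step (suc n) ih | suc (suc i)   , m , e , _ | inj₁ 1+m<f with m≤n⇒∃[o]m+o≡n 1+m<f
... | o , 2+m+o≡f = square-bound-split i ih e (trans (cong suc (+-suc m o)) 2+m+o≡f)

square-bound : ∀ n → SquareBound n
square-bound = <-rec SquareBound square-bound-step

F[fib²-1]≡fib : ∀ r {n} → suc n ≡ fib r * fib r → F n ≡ fib r
F[fib²-1]≡fib zero          refl = refl
F[fib²-1]≡fib (suc zero)    refl = refl
F[fib²-1]≡fib (suc (suc a)) {n} e = begin
  F n                        ≡⟨ cong F n≡ ⟩
  F (fib (3 + (a + a)) + m)  ≡⟨ F-split (suc (a + a)) (trans (cong₂ _+_ 1+m≡ 1+m′≡) (fib²+fib²≡fib a)) ⟩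
  F m + F m′                 ≡⟨ cong₂ _+_ (F[fib²-1]≡fib a 1+m≡) (F[fib²-1]≡fib (suc a) 1+m′≡) ⟩
  fib a + fib (suc a)        ≡⟨ +-comm (fib a) (fib (suc a)) ⟩
  fib (2 + a)                ∎
  where
  open ≡-Reasoning
  m m′ : ℕ
  m  = proj₁ (fib²≡suc a)
  m′ = proj₁ (fib²≡suc (suc a))
  1+m≡ : suc m ≡ fib a * fib a
  1+m≡ = proj₂ (fib²≡suc a)
  1+m′≡ : suc m′ ≡ fib (suc a) * fib (suc a)
  1+m′≡ = proj₂ (fib²≡suc (suc a))
  n≡ : n ≡ fib (3 + (a + a)) + m
  n≡ = suc-injective (trans e (sym (fib[3+2a]+fib²≡fib² a refl 1+m≡)))

theorem4p5 : (n : ℕ) →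
    (F n * F n ≤ suc n) × ((F n * F n ≡ suc n) ⇔ (∃[ r ] suc n ≡ fib r * fib r))
theorem4p5 n = bound (square-bound n) , mk⇔ (equality (square-bound n)) fib-square⇒tight
  where
  fib-square⇒tight : ∃[ r ] suc n ≡ fib r * fib r → F n * F n ≡ suc n
  fib-square⇒tight (r , e) = trans (cong (λ x → x * x) (F[fib²-1]≡fib r e)) (sym e)
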